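{- Let $n<m$, let $\mathfrak A$ be an atomic cylindric algebra of dimension $n$, and suppose $\mathfrak A\subseteq_c\mathrm{Nr}_n\mathfrak C$ for some $\mathfrak C\in\mathrm{CA}_m$. Then for every $x\in C\setminus\{0\}$ and all $i_0,\dots,i_{n-1}<m$ there is an atom $a$ of $\mathfrak A$ such that $s_{i_0\ldots i_{n-1}}a\cdot x\neq 0$.
   Context: $\mathrm{Nr}_n\mathfrak C$ is the algebra with universe $\{y\in C: c_iy=y\text{ for all } n\le i<m\}$ and the operations of $\mathfrak C$ with indices $<n$. $\mathfrak A\subseteq_c\mathfrak B$ means $\mathfrak A$ is a subalgebra of $\mathfrak B$ such that every subset of $A$ with a supremum in $\mathfrak A$ has the same supremum in $\mathfrak B$. In $\mathfrak C$, $s^i_j y=c_i(d_{ij}\cdot y)$ for $i\ne j$ and $s^i_i$ is the identity. An $sc$ word is a finite string of operators $s^i_j$ and $c_k$ ($i,j,k<m$); it induces a partial map $\hat w:m\to m$ by $\hat\epsilon=\mathrm{Id}$, $\widehat{w s^i_j}=\hat w\circ[i|j]$ (where $[i|j]$ sends $i$ to $j$ and fixes all else), $\widehat{wc_i}=\hat w\restriction(m\setminus\{i\})$. For $i_0,\dots,i_{n-1}<m$, $s_{i_0\ldots i_{n-1}}$ denotes the operator of $\mathfrak C$ given by an $sc$ word $w$ whose induced map sends $l\mapsto i_l$ for $l<n$ (this does not depend on the choice of $w$, in the sense of Hirsch–Hodkinson). -}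

module Defs where

open import Level using (Level; _⊔_) renaming (suc to lsuc)
open import Data.Nat using (ℕ; _≤_; _<_)
open import Data.Fin using (Fin; toℕ; inject≤; _≟_)
open import Data.Maybe using (Maybe; just; nothing)
open import Data.Product using (Σ; ∃; _×_; _,_)
open import Data.Sum using (_⊎_)
import Data.Unit
open import Relation.Nullary using (¬_; yes; no)
open import Relation.Binary.PropositionalEquality using (_≡_)
open import Algebra.Lattice.Bundles using (BooleanAlgebra)

record CA (m : ℕ) (c ℓ : Level) : Set (lsuc (c ⊔ ℓ)) where
  field
    boolAlg : BooleanAlgebra c ℓ
  open BooleanAlgebra boolAlg public renaming (¬_ to -_; ⊤ to 𝟏; ⊥ to 𝟎)
  _≤ᴮ_ : Carrier → Carrier → Set ℓ
  x ≤ᴮ y = (x ∧ y) ≈ x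
  _·_ : Carrier → Carrier → Carrier
  x · y = x ∧ y
  field
    cyl  : Fin m → Carrier → Carrier
    diag : Fin m → Fin m → Carrier
    cyl-cong : ∀ i {x y} → x ≈ y → cyl i x ≈ cyl i y
    C1 : ∀ i → cyl i 𝟎 ≈ 𝟎
    C2 : ∀ i x → x ≤ᴮ cyl i x
    C3 : ∀ i x y → cyl i (x ∧ cyl i y) ≈ (cyl i x ∧ cyl i y)
    C4 : ∀ i j x → cyl i (cyl j x) ≈ cyl j (cyl i x)
    C5 : ∀ i → diag i i ≈ 𝟏
    C6 : ∀ i j k → ¬ k ≡ i → ¬ k ≡ j → diag i j ≈ cyl k (diag i k ∧ diag k j)
    C7 : ∀ i j x → ¬ i ≡ j →
         (cyl i (diag i j ∧ x) ∧ cyl i (diag i j ∧ - x)) ≈ 𝟎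

  subst : Fin m → Fin m → Carrier → Carrier
  subst i j y with i ≟ j
  ... | yes _ = y
  ... | no  _ = cyl i (diag i j ∧ y)

  -- supremum of a subset P, computed relative to the elements satisfying Q
  -- (Q = everything gives the supremum in the algebra itself)
  IsSupIn : ∀ {p q} → (Carrier → Set q) → (Carrier → Set p) → Carrier → Set (c ⊔ ℓ ⊔ p ⊔ q)
  IsSupIn Q P s = Q s × (∀ x → P x → x ≤ᴮ s)
                  × (∀ u → Q u → (∀ x → P x → x ≤ᴮ u) → s ≤ᴮ u)

  IsAtom : Carrier → Set (c ⊔ ℓ)
  IsAtom a = ¬ (a ≈ 𝟎) × (∀ b → b ≤ᴮ a → (b ≈ 𝟎) ⊎ (b ≈ a))

  IsAtomic : Set (c ⊔ ℓ)
  IsAtomic = ∀ x → ¬ (x ≈ 𝟎) → Σ Carrier λ a → IsAtom a × a ≤ᴮ x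

data SCWord (m : ℕ) : Set where
  ε    : SCWord m
  _·s_,_ : SCWord m → Fin m → Fin m → SCWord m
  _·c_   : SCWord m → Fin m → SCWord m

repl : ∀ {m} → Fin m → Fin m → Fin m → Fin m
repl i j k with k ≟ i
... | yes _ = j
... | no  _ = k

hat : ∀ {m} → SCWord m → Fin m → Maybe (Fin m)
hat ε k = just k
hat (w ·s i , j) k = hat w (repl i j k)
hat (w ·c i) k with k ≟ i
... | yes _ = nothing
... | no  _ = hat w k

-- the operator of 𝔆 given by a word (leftmost letter applied last)
⟦_⟧ : ∀ {m c ℓ} → SCWord m → (C : CA m c ℓ) → CA.Carrier C → CA.Carrier C
⟦ ε ⟧ C y = y
⟦ w ·s i , j ⟧ C y = ⟦ w ⟧ C (CA.subst C i j y)
⟦ w ·c i ⟧ C y = ⟦ w ⟧ C (CA.cyl C i y)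

module _ {n m : ℕ} (n≤m : n ≤ m) where

  ι : Fin n → Fin m
  ι i = inject≤ i n≤m

  InNr : ∀ {c ℓ} (C : CA m c ℓ) → CA.Carrier C → Set ℓ
  InNr C y = ∀ (i : Fin m) → n ≤ toℕ i → CA._≈_ C (CA.cyl C i y) y

  -- 𝔄 ⊆_c Nr_n 𝔆, with 𝔄 identified with its image under an injective
  -- homomorphism h into Nr_n 𝔆 (operations of 𝔆 with indices < n)
  record CompleteSubNr {a ℓa c ℓc} (A : CA n a ℓa) (C : CA m c ℓc)
         : Set (lsuc a ⊔ ℓa ⊔ c ⊔ ℓc) where
    private
      module A = CA A
      module C = CA C
    field
      h      : A.Carrier → C.Carrier
      h-cong : ∀ {x y} → x A.≈ y → h x C.≈ h y
      h-inj  : ∀ {x y} → h x C.≈ h y → x A.≈ y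
      h-Nr   : ∀ x → InNr C (h x)
      h-∨    : ∀ x y → h (x A.∨ y) C.≈ (h x C.∨ h y)
      h-∧    : ∀ x y → h (x A.∧ y) C.≈ (h x C.∧ h y)
      h-¬    : ∀ x → h (A.- x) C.≈ (C.- h x)
      h-⊤    : h A.𝟏 C.≈ C.𝟏
      h-⊥    : h A.𝟎 C.≈ C.𝟎
      h-cyl  : ∀ i x → h (A.cyl i x) C.≈ C.cyl (ι i) (h x)
      h-diag : ∀ i j → h (A.diag i j) C.≈ C.diag (ι i) (ι j)
      h-complete : ∀ (P : A.Carrier → Set a) s →
        A.IsSupIn (λ _ → Level.Lift a Data.Unit.⊤) P s →
        C.IsSupIn (InNr C) (λ y → Σ A.Carrier λ x → P x × (y C.≈ h x)) (h s)

module Submission where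

-- Every sc word w has a "nonzero conjugate": for x ≠ 0 there is z ≠ 0 such that
-- ⟦ w ⟧ y · x = 0 forces y · z = 0 (c_k is self-conjugate, and s^i_j y · x = 0 forces
-- y · d_ij · c_i x = 0). Cylindrifying z along all indices ≥ n gives z′ ≠ 0 in Nr_n C that is
-- still disjoint from every element of Nr_n C disjoint from z. If no atom a had h a · z ≠ 0,
-- then -z′ ∈ Nr_n C would bound all images of atoms; as A is atomic their supremum is 1,
-- and by completeness of the embedding h 1 = 1 ≤ -z′, i.e. z′ = 0.

open import Defs
open import Level using (_⊔_; Lift; lift; lower)
open import Data.Nat using (ℕ; _≤_; _<_; _≤?_)
open import Data.Nat.Properties using (<⇒≤)
open import Data.Fin using (Fin; toℕ; _≟_)
open import Data.Maybe using (just)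
open import Data.Product using (Σ; _×_; _,_; proj₁)
open import Data.List using (List; []; _∷_; foldr; filter; allFin)
open import Data.List.Relation.Unary.All as All using (All; []; _∷_)
open import Data.List.Relation.Unary.All.Properties using (all-filter)
open import Data.List.Relation.Unary.Any using (here; there)
open import Data.List.Membership.Propositional using (_∈_)
open import Data.List.Membership.Propositional.Properties using (∈-allFin; ∈-filter⁺)
open import Data.Unit using (⊤; tt)
open import Function using (id; _∘_)
open import Relation.Nullary using (¬_; Dec; yes; no)
open import Relation.Nullary.Negation using (Stable)
open import Relation.Nullary.Decidable using (True; toWitness; fromWitness; map′; decidable-stable)
open import Relation.Binary.PropositionalEquality using (_≡_) renaming (refl to ≡-refl)
open import Axiom.ExcludedMiddle using (ExcludedMiddle)
open import Algebra.Lattice.Bundles using (BooleanAlgebra)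
import Algebra.Lattice.Properties.BooleanAlgebra as BooleanAlgebraProperties
import Relation.Binary.Reasoning.Setoid as SetoidReasoning

em-lower : ∀ {ℓ} ℓ′ → ExcludedMiddle (ℓ ⊔ ℓ′) → ExcludedMiddle ℓ
em-lower ℓ′ em {P} = map′ lower lift (em {Lift ℓ′ P})

em⇒stable : ∀ {ℓ} ℓ′ → ExcludedMiddle (ℓ ⊔ ℓ′) → {P : Set ℓ} → Stable P
em⇒stable ℓ′ em = decidable-stable (em-lower ℓ′ em)

module BooleanAlgebraLemmas {b₁ b₂} (B : BooleanAlgebra b₁ b₂) where
  open BooleanAlgebra B renaming (¬_ to -_; ⊤ to 𝟏; ⊥ to 𝟎)
  open BooleanAlgebraProperties B using (∧-identityʳ; ∧-zeroʳ; ∨-identityˡ; ¬-involutive; ¬⊤≈⊥; ¬⊥≈⊤)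
  open SetoidReasoning setoid

  disjoint⇒≤- : ∀ x y → (x ∧ y) ≈ 𝟎 → (x ∧ - y) ≈ x
  disjoint⇒≤- x y x∧y≈𝟎 = begin
    x ∧ - y              ≈⟨ sym (∨-identityˡ _) ⟩
    𝟎 ∨ (x ∧ - y)        ≈⟨ ∨-congʳ (sym x∧y≈𝟎) ⟩
    (x ∧ y) ∨ (x ∧ - y)  ≈⟨ sym (∧-distribˡ-∨ x y (- y)) ⟩
    x ∧ (y ∨ - y)        ≈⟨ ∧-congˡ (∨-complementʳ y) ⟩
    x ∧ 𝟏                ≈⟨ ∧-identityʳ x ⟩
    x                    ∎

  ≤-⇒disjoint : ∀ x y → (x ∧ - y) ≈ x → (x ∧ y) ≈ 𝟎
  ≤-⇒disjoint x y x≤-y = begin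
    x ∧ y          ≈⟨ ∧-congʳ (sym x≤-y) ⟩
    (x ∧ - y) ∧ y  ≈⟨ ∧-assoc x (- y) y ⟩
    x ∧ (- y ∧ y)  ≈⟨ ∧-congˡ (∧-complementˡ y) ⟩
    x ∧ 𝟎          ≈⟨ ∧-zeroʳ x ⟩
    𝟎              ∎

  -≈𝟎⇒≈𝟏 : ∀ {x} → - x ≈ 𝟎 → x ≈ 𝟏
  -≈𝟎⇒≈𝟏 {x} -x≈𝟎 = begin
    x      ≈⟨ sym (¬-involutive x) ⟩
    - - x  ≈⟨ ¬-cong -x≈𝟎 ⟩
    - 𝟎    ≈⟨ ¬⊥≈⊤ ⟩
    𝟏      ∎

  -≈𝟏⇒≈𝟎 : ∀ {x} → - x ≈ 𝟏 → x ≈ 𝟎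
  -≈𝟏⇒≈𝟎 {x} -x≈𝟏 = begin
    x      ≈⟨ sym (¬-involutive x) ⟩
    - - x  ≈⟨ ¬-cong -x≈𝟏 ⟩
    - 𝟏    ≈⟨ ¬⊤≈⊥ ⟩
    𝟎      ∎

module CylindricAlgebraLemmas {m c ℓ} (C : CA m c ℓ) where
  open CA C
  open BooleanAlgebraLemmas boolAlg
  open BooleanAlgebraProperties boolAlg using (∧-identityˡ; ∧-zeroʳ; ∧-idem)
  open SetoidReasoning setoid

  cyl-𝟏 : ∀ k → cyl k 𝟏 ≈ 𝟏
  cyl-𝟏 k = trans (sym (∧-identityˡ _)) (C2 k 𝟏)

  cyl-idem : ∀ k x → cyl k (cyl k x) ≈ cyl k x
  cyl-idem k x = begin
    cyl k (cyl k x)      ≈⟨ cyl-cong k (sym (∧-identityˡ _)) ⟩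
    cyl k (𝟏 ∧ cyl k x)  ≈⟨ C3 k 𝟏 x ⟩
    cyl k 𝟏 ∧ cyl k x    ≈⟨ ∧-congʳ (cyl-𝟏 k) ⟩
    𝟏 ∧ cyl k x          ≈⟨ ∧-identityˡ _ ⟩
    cyl k x              ∎

  cyl≈𝟎⇒≈𝟎 : ∀ k x → cyl k x ≈ 𝟎 → x ≈ 𝟎
  cyl≈𝟎⇒≈𝟎 k x cx≈𝟎 = begin
    x          ≈⟨ sym (C2 k x) ⟩
    x ∧ cyl k x  ≈⟨ ∧-congˡ cx≈𝟎 ⟩
    x ∧ 𝟎      ≈⟨ ∧-zeroʳ x ⟩
    𝟎          ∎

  cyl-mono : ∀ k x y → (x ∧ y) ≈ x → (cyl k x ∧ cyl k y) ≈ cyl k x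
  cyl-mono k x y x≤y = begin
    cyl k x ∧ cyl k y    ≈⟨ sym (C3 k x y) ⟩
    cyl k (x ∧ cyl k y)  ≈⟨ cyl-cong k x≤cy ⟩
    cyl k x              ∎
    where
    x≤cy : (x ∧ cyl k y) ≈ x
    x≤cy = begin
      x ∧ cyl k y        ≈⟨ ∧-congʳ (sym x≤y) ⟩
      (x ∧ y) ∧ cyl k y  ≈⟨ ∧-assoc _ _ _ ⟩
      x ∧ (y ∧ cyl k y)  ≈⟨ ∧-congˡ (C2 k y) ⟩
      x ∧ y              ≈⟨ x≤y ⟩
      x                  ∎

  cyl-fixed-∧ : ∀ k x y → cyl k x ≈ x → cyl k (x ∧ y) ≈ (x ∧ cyl k y)
  cyl-fixed-∧ k x y cx≈x = begin
    cyl k (x ∧ y)        ≈⟨ cyl-cong k (trans (∧-comm _ _) (∧-congˡ (sym cx≈x))) ⟩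
    cyl k (y ∧ cyl k x)  ≈⟨ C3 k y x ⟩
    cyl k y ∧ cyl k x    ≈⟨ ∧-congˡ cx≈x ⟩
    cyl k y ∧ x          ≈⟨ ∧-comm _ _ ⟩
    x ∧ cyl k y          ∎

  cyl-disjoint-fixed : ∀ k x y → cyl k x ≈ x → (x ∧ y) ≈ 𝟎 → (x ∧ cyl k y) ≈ 𝟎
  cyl-disjoint-fixed k x y cx≈x x∧y≈𝟎 = begin
    x ∧ cyl k y    ≈⟨ sym (cyl-fixed-∧ k x y cx≈x) ⟩
    cyl k (x ∧ y)  ≈⟨ cyl-cong k x∧y≈𝟎 ⟩
    cyl k 𝟎        ≈⟨ C1 k ⟩
    𝟎              ∎

  cyl-fixed-complement : ∀ k x → cyl k x ≈ x → cyl k (- x) ≈ - x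
  cyl-fixed-complement k x cx≈x = begin
    cyl k (- x)        ≈⟨ sym (disjoint⇒≤- _ _ cx∧x≈𝟎) ⟩
    cyl k (- x) ∧ - x  ≈⟨ ∧-comm _ _ ⟩
    - x ∧ cyl k (- x)  ≈⟨ C2 k (- x) ⟩
    - x                ∎
    where
    cx∧x≈𝟎 : (cyl k (- x) ∧ x) ≈ 𝟎
    cx∧x≈𝟎 = trans (∧-comm _ _) (cyl-disjoint-fixed k x (- x) cx≈x (∧-complementʳ x))

  cyl-adjoint : ∀ k x y → (cyl k y ∧ x) ≈ 𝟎 → (y ∧ cyl k x) ≈ 𝟎
  cyl-adjoint k x y cy∧x≈𝟎 = begin
    y ∧ cyl k x                ≈⟨ ∧-congʳ (sym (C2 k y)) ⟩
    (y ∧ cyl k y) ∧ cyl k x    ≈⟨ ∧-assoc _ _ _ ⟩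
    y ∧ (cyl k y ∧ cyl k x)    ≈⟨ ∧-congˡ (cyl-disjoint-fixed k (cyl k y) x (cyl-idem k y) cy∧x≈𝟎) ⟩
    y ∧ 𝟎                      ≈⟨ ∧-zeroʳ y ⟩
    𝟎                          ∎

  cyl-diag≈𝟏 : ∀ i j → ¬ i ≡ j → cyl i (diag i j) ≈ 𝟏
  cyl-diag≈𝟏 i j i≢j = begin
    cyl i (diag i j)                                ≈⟨ sym (∧-identityˡ _) ⟩
    𝟏 ∧ cyl i (diag i j)                            ≈⟨ ∧-congʳ 𝟏≈cd ⟩
    cyl i (diag j i ∧ diag i j) ∧ cyl i (diag i j)  ≈⟨ cyl-mono i _ _ d∧d≤d ⟩
    cyl i (diag j i ∧ diag i j)                     ≈⟨ sym 𝟏≈cd ⟩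
    𝟏                                               ∎
    where
    𝟏≈cd : 𝟏 ≈ cyl i (diag j i ∧ diag i j)
    𝟏≈cd = trans (sym (C5 j)) (C6 j j i i≢j i≢j)
    d∧d≤d : ((diag j i ∧ diag i j) ∧ diag i j) ≈ (diag j i ∧ diag i j)
    d∧d≤d = trans (∧-assoc _ _ _) (∧-congˡ (∧-idem _))

module Conjugates {m c ℓ} (C : CA m c ℓ) where
  open CA C
  open CylindricAlgebraLemmas C
  open BooleanAlgebraProperties boolAlg using (∧-identityˡ)
  open SetoidReasoning setoid

  HasNonzeroConjugate : (Carrier → Carrier) → Set (c ⊔ ℓ)
  HasNonzeroConjugate f = ∀ x → ¬ x ≈ 𝟎 →
    Σ Carrier λ z → ¬ z ≈ 𝟎 × (∀ y → (f y ∧ x) ≈ 𝟎 → (y ∧ z) ≈ 𝟎)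

  id-hasNonzeroConjugate : HasNonzeroConjugate id
  id-hasNonzeroConjugate x x≉𝟎 = x , x≉𝟎 , λ _ fy∧x≈𝟎 → fy∧x≈𝟎

  ∘-hasNonzeroConjugate : ∀ {f g} → HasNonzeroConjugate f → HasNonzeroConjugate g →
                          HasNonzeroConjugate (f ∘ g)
  ∘-hasNonzeroConjugate f-conj g-conj x x≉𝟎 with f-conj x x≉𝟎
  ... | z , z≉𝟎 , f-disj with g-conj z z≉𝟎
  ... | z′ , z′≉𝟎 , g-disj = z′ , z′≉𝟎 , λ y fgy∧x≈𝟎 → g-disj y (f-disj _ fgy∧x≈𝟎)

  cyl-hasNonzeroConjugate : ∀ k → HasNonzeroConjugate (cyl k)
  cyl-hasNonzeroConjugate k x x≉𝟎 =
    cyl k x , (λ cx≈𝟎 → x≉𝟎 (cyl≈𝟎⇒≈𝟎 k x cx≈𝟎)) , λ y → cyl-adjoint k x y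

  subst-hasNonzeroConjugate : ∀ i j → HasNonzeroConjugate (subst i j)
  subst-hasNonzeroConjugate i j with i ≟ j
  ... | yes _   = id-hasNonzeroConjugate
  ... | no i≢j = λ x x≉𝟎 → diag i j ∧ cyl i x , d∧cx≉𝟎 x x≉𝟎 , λ y → disjoint x y
    where
    d∧cx≉𝟎 : ∀ x → ¬ x ≈ 𝟎 → ¬ (diag i j ∧ cyl i x) ≈ 𝟎
    d∧cx≉𝟎 x x≉𝟎 d∧cx≈𝟎 = x≉𝟎 (cyl≈𝟎⇒≈𝟎 i x (begin
      cyl i x                     ≈⟨ sym (∧-identityˡ _) ⟩
      𝟏 ∧ cyl i x                 ≈⟨ ∧-congʳ (sym (cyl-diag≈𝟏 i j i≢j)) ⟩
      cyl i (diag i j) ∧ cyl i x  ≈⟨ sym (C3 i _ _) ⟩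
      cyl i (diag i j ∧ cyl i x)  ≈⟨ cyl-cong i d∧cx≈𝟎 ⟩
      cyl i 𝟎                     ≈⟨ C1 i ⟩
      𝟎                           ∎))
    disjoint : ∀ x y → (cyl i (diag i j ∧ y) ∧ x) ≈ 𝟎 → (y ∧ (diag i j ∧ cyl i x)) ≈ 𝟎
    disjoint x y s∧x≈𝟎 = begin
      y ∧ (diag i j ∧ cyl i x)  ≈⟨ sym (∧-assoc _ _ _) ⟩
      (y ∧ diag i j) ∧ cyl i x  ≈⟨ ∧-congʳ (∧-comm _ _) ⟩
      (diag i j ∧ y) ∧ cyl i x  ≈⟨ cyl-adjoint i x _ s∧x≈𝟎 ⟩
      𝟎                         ∎

  ⟦⟧-hasNonzeroConjugate : ∀ w → HasNonzeroConjugate (⟦ w ⟧ C)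
  ⟦⟧-hasNonzeroConjugate ε = id-hasNonzeroConjugate
  ⟦⟧-hasNonzeroConjugate (w ·s i , j) =
    ∘-hasNonzeroConjugate (⟦⟧-hasNonzeroConjugate w) (subst-hasNonzeroConjugate i j)
  ⟦⟧-hasNonzeroConjugate (w ·c k) =
    ∘-hasNonzeroConjugate (⟦⟧-hasNonzeroConjugate w) (cyl-hasNonzeroConjugate k)

module IteratedCylindrification {m c ℓ} (C : CA m c ℓ) where
  open CA C
  open CylindricAlgebraLemmas C

  cyls : List (Fin m) → Carrier → Carrier
  cyls ks x = foldr cyl x ks

  cyls≈𝟎⇒≈𝟎 : ∀ ks x → cyls ks x ≈ 𝟎 → x ≈ 𝟎
  cyls≈𝟎⇒≈𝟎 []       x x≈𝟎  = x≈𝟎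
  cyls≈𝟎⇒≈𝟎 (k ∷ ks) x cx≈𝟎 = cyls≈𝟎⇒≈𝟎 ks x (cyl≈𝟎⇒≈𝟎 k _ cx≈𝟎)

  cyls-fixed : ∀ {k ks} x → k ∈ ks → cyl k (cyls ks x) ≈ cyls ks x
  cyls-fixed {k} {_ ∷ _} x (here ≡-refl) = cyl-idem k _
  cyls-fixed {k} {k′ ∷ _} x (there k∈ks) = trans (C4 k k′ _) (cyl-cong k′ (cyls-fixed x k∈ks))

  cyls-disjoint-fixed : ∀ {ks} x y → All (λ k → cyl k y ≈ y) ks →
                        (y ∧ x) ≈ 𝟎 → (y ∧ cyls ks x) ≈ 𝟎
  cyls-disjoint-fixed x y []           y∧x≈𝟎 = y∧x≈𝟎
  cyls-disjoint-fixed x y (cy≈y ∷ fix) y∧x≈𝟎 =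
    cyl-disjoint-fixed _ y _ cy≈y (cyls-disjoint-fixed x y fix y∧x≈𝟎)

module NeatReduct {n m c ℓ} (n≤m : n ≤ m) (C : CA m c ℓ) where
  open CA C
  open IteratedCylindrification C

  isOuter? : (k : Fin m) → Dec (n ≤ toℕ k)
  isOuter? k = n ≤? toℕ k

  outerIndices : List (Fin m)
  outerIndices = filter isOuter? (allFin m)

  Nr-closure : ∀ x → ¬ x ≈ 𝟎 → Σ Carrier λ x′ → InNr n≤m C x′ × ¬ x′ ≈ 𝟎 ×
               (∀ y → InNr n≤m C y → (y ∧ x) ≈ 𝟎 → (y ∧ x′) ≈ 𝟎)
  Nr-closure x x≉𝟎 =
    cyls outerIndices x ,
    (λ k n≤k → cyls-fixed x (∈-filter⁺ isOuter? (∈-allFin k) n≤k)) ,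
    (λ x′≈𝟎 → x≉𝟎 (cyls≈𝟎⇒≈𝟎 outerIndices x x′≈𝟎)) ,
    λ y y∈Nr → cyls-disjoint-fixed x y (All.map (y∈Nr _) (all-filter isOuter? (allFin m)))

module Atoms {n a ℓa} (A : CA n a ℓa) (em : ExcludedMiddle (a ⊔ ℓa)) where
  open CA A
  open BooleanAlgebraLemmas boolAlg
  open BooleanAlgebraProperties boolAlg using (∧-identityʳ)

  -- Suprema in CompleteSubNr range over predicates in Set a, while IsAtom lands in
  -- Set (a ⊔ ℓa); under excluded middle, True of its decision is an equivalent small one.
  IsAtomᵇ : Carrier → Set a
  IsAtomᵇ x = Lift a (True (em {IsAtom x}))

  atomic⇒sup-atoms≈𝟏 : IsAtomic → IsSupIn (λ _ → Lift a ⊤) IsAtomᵇ 𝟏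
  atomic⇒sup-atoms≈𝟏 atomic = lift tt , (λ x _ → ∧-identityʳ x) , least
    where
    least : ∀ u → Lift a ⊤ → (∀ x → IsAtomᵇ x → x ≤ᴮ u) → 𝟏 ≤ᴮ u
    least u _ atoms≤u = trans (∧-congˡ (-≈𝟎⇒≈𝟏 -u≈𝟎)) (∧-identityʳ 𝟏)
      where
      -u≈𝟎 : - u ≈ 𝟎
      -u≈𝟎 = em⇒stable a em λ -u≉𝟎 →
        let (b , b-atom , b≤-u) = atomic (- u) -u≉𝟎
            b≤u = atoms≤u b (lift (fromWitness b-atom))
        in proj₁ b-atom (trans (sym b≤u) (≤-⇒disjoint b u b≤-u))

module CompleteEmbedding {a ℓa c ℓc} {n m : ℕ} {n≤m : n ≤ m}
  {A : CA n a ℓa} {C : CA m c ℓc} (E : CompleteSubNr n≤m A C) where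
  private
    module A = CA A
  open CA C
  open CompleteSubNr E
  open BooleanAlgebraLemmas boolAlg
  open CylindricAlgebraLemmas C using (cyl-fixed-complement)
  open BooleanAlgebraProperties boolAlg using (∧-identityˡ)

  Nr-disjoint-atoms⇒≈𝟎 : (em : ExcludedMiddle (a ⊔ ℓa)) → A.IsAtomic →
    ∀ y → InNr n≤m C y → (∀ x → A.IsAtom x → (h x ∧ y) ≈ 𝟎) → y ≈ 𝟎
  Nr-disjoint-atoms⇒≈𝟎 em atomic y y∈Nr atoms⊥y = -≈𝟏⇒≈𝟎 (begin
    - y          ≈⟨ sym (∧-identityˡ _) ⟩
    𝟏 ∧ - y      ≈⟨ ∧-congʳ (sym h-⊤) ⟩
    h A.𝟏 ∧ - y  ≈⟨ h𝟏≤-y ⟩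
    h A.𝟏        ≈⟨ h-⊤ ⟩
    𝟏            ∎)
    where
    open SetoidReasoning setoid
    open Atoms A em using (IsAtomᵇ; atomic⇒sup-atoms≈𝟏)
    -y∈Nr : InNr n≤m C (- y)
    -y∈Nr k n≤k = cyl-fixed-complement k y (y∈Nr k n≤k)
    -y-bounds-atoms : ∀ y′ → Σ A.Carrier (λ x → IsAtomᵇ x × y′ ≈ h x) → y′ ≤ᴮ (- y)
    -y-bounds-atoms y′ (x , x-atom , y′≈hx) = begin
      y′ ∧ - y   ≈⟨ ∧-congʳ y′≈hx ⟩
      h x ∧ - y  ≈⟨ disjoint⇒≤- (h x) y (atoms⊥y x (toWitness (lower x-atom))) ⟩
      h x        ≈⟨ sym y′≈hx ⟩
      y′         ∎
    h𝟏≤-y : h A.𝟏 ≤ᴮ (- y)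
    h𝟏≤-y = let (_ , _ , least) = h-complete IsAtomᵇ A.𝟏 (atomic⇒sup-atoms≈𝟏 atomic)
            in least (- y) -y∈Nr -y-bounds-atoms

-- The argument works for every sc word w.
mainTheorem7 : ∀ {a ℓa c ℓc} {n m : ℕ} (n<m : n < m)
  (A : CA n a ℓa) (C : CA m c ℓc) →
  ExcludedMiddle (a ⊔ ℓa ⊔ c ⊔ ℓc) →
  CA.IsAtomic A →
  (E : CompleteSubNr (<⇒≤ n<m) A C) →
  ∀ (x : CA.Carrier C) → ¬ (CA._≈_ C x (CA.𝟎 C)) →
  ∀ (i : Fin n → Fin m) (w : SCWord m) →
  (∀ (l : Fin n) → hat w (ι (<⇒≤ n<m) l) ≡ just (i l)) →
  Σ (CA.Carrier A) λ at → CA.IsAtom A at ×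
    ¬ (CA._≈_ C (CA._·_ C (⟦ w ⟧ C (CompleteSubNr.h E at)) x) (CA.𝟎 C))
mainTheorem7 {a} {ℓa} {c} {ℓc} n<m A C em atomic E x x≉𝟎 _ w _
  with Conjugates.⟦⟧-hasNonzeroConjugate C w x x≉𝟎
... | z , z≉𝟎 , x⊥⇒z⊥
  with NeatReduct.Nr-closure (<⇒≤ n<m) C z z≉𝟎
... | z′ , z′∈Nr , z′≉𝟎 , z⊥⇒z′⊥ =
  em⇒stable c em λ no-witness →
    z′≉𝟎 (Nr-disjoint-atoms⇒≈𝟎 (em-lower (c ⊔ ℓc) em) atomic z′ z′∈Nr
      λ at at-atom → z⊥⇒z′⊥ (h at) (h-Nr at) (h-atom⊥z no-witness at at-atom))
  where
  open CA C
  open CompleteSubNr E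
  open CompleteEmbedding E
  h-atom⊥z : ¬ Σ (CA.Carrier A) (λ at → CA.IsAtom A at × ¬ ((⟦ w ⟧ C (h at) ∧ x) ≈ 𝟎)) →
             ∀ at → CA.IsAtom A at → (h at ∧ z) ≈ 𝟎
  h-atom⊥z no-witness at at-atom = em⇒stable (a ⊔ ℓa ⊔ c) em λ hat∧z≉𝟎 →
    no-witness (at , at-atom , λ wh∧x≈𝟎 → hat∧z≉𝟎 (x⊥⇒z⊥ (h at) wh∧x≈𝟎))
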